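{- Let $\Psi:\mathbb{Q}[x]\to\mathbb{Q}$ be the linear form with $\Psi(x^n)=B_n$ for all $n\ge0$, where $\frac{t}{e^t-1}=\sum_{n\ge0}B_n\frac{t^n}{n!}$. For every integer $k\ge0$, $$\Psi\!\left(\binom{x+2}{2}\binom{ -x-3+k}{k}\binom{x+k}{k}\right)=-\frac{1}{(2k+3)(2k+1)(2k-1)}.$$
   Context: For a polynomial $p(x)$ and integer $m\ge0$, $\binom{p(x)}{m}=\frac{p(x)(p(x)-1)\cdots(p(x)-m+1)}{m!}\in\mathbb{Q}[x]$. -}

module Defs where

open import Data.Nat as ℕ using (ℕ; zero; suc)
open import Data.Integer as ℤ using (ℤ; +_)
open import Data.Rational as ℚ using (ℚ; 0ℚ; 1ℚ; _/_)
open import Data.List using (List; []; _∷_)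

-- Polynomials in ℚ[x] as coefficient lists, lowest degree first:
-- a₀ ∷ a₁ ∷ … ∷ aₙ ∷ []  represents  a₀ + a₁ x + … + aₙ xⁿ.
Poly : Set
Poly = List ℚ

ℕtoℚ : ℕ → ℚ
ℕtoℚ n = (+ n) / 1

ℤtoℚ : ℤ → ℚ
ℤtoℚ z = z / 1

const : ℚ → Poly
const c = c ∷ []

X : Poly
X = 0ℚ ∷ 1ℚ ∷ []

infixl 6 _+ₚ_ _-ₚ_
infixl 7 _*ₚ_ _·ₚ_

_+ₚ_ : Poly → Poly → Poly
[] +ₚ q = q
(a ∷ p) +ₚ [] = a ∷ p
(a ∷ p) +ₚ (b ∷ q) = (a ℚ.+ b) ∷ (p +ₚ q)

_·ₚ_ : ℚ → Poly → Poly
c ·ₚ [] = []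
c ·ₚ (a ∷ p) = (c ℚ.* a) ∷ (c ·ₚ p)

-ₚ_ : Poly → Poly
-ₚ p = ℚ.- 1ℚ ·ₚ p

_-ₚ_ : Poly → Poly → Poly
p -ₚ q = p +ₚ (-ₚ q)

_*ₚ_ : Poly → Poly → Poly
[] *ₚ q = []
(a ∷ p) *ₚ q = (a ·ₚ q) +ₚ (0ℚ ∷ (p *ₚ q))

invFact : ℕ → ℚ
invFact zero = 1ℚ
invFact (suc m) = invFact m ℚ.* ((+ 1) / suc m)

fallingProd : Poly → ℕ → Poly
fallingProd p zero = const 1ℚ
fallingProd p (suc m) = fallingProd p m *ₚ (p -ₚ const (ℕtoℚ m))

choose : Poly → ℕ → Poly
choose p m = invFact m ·ₚ fallingProd p m

sumTo : ℕ → (ℕ → ℚ) → ℚ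
sumTo zero f = f 0
sumTo (suc n) f = sumTo n f ℚ.+ f (suc n)

-- B is the sequence of Bernoulli numbers defined by t/(eᵗ-1) = Σ Bₙ tⁿ/n!,
-- expressed as the formal power series identity
--   (Σ Bₙ tⁿ/n!) · ((eᵗ-1)/t) = 1,   where (eᵗ-1)/t = Σ tᵐ/(m+1)!,
-- i.e. for every n:  Σ_{j=0}^{n} (B j / j!) · 1/(n-j+1)! = [n = 0].
kronecker0 : ℕ → ℚ
kronecker0 zero = 1ℚ
kronecker0 (suc _) = 0ℚ

IsBernoulli : (ℕ → ℚ) → Set
IsBernoulli B = ∀ n → sumTo n (λ j → (B j ℚ.* invFact j) ℚ.* invFact (suc (n ℕ.∸ j)))
                      ≡ kronecker0 n
  where open import Relation.Binary.PropositionalEquality using (_≡_)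

Ψ-aux : (ℕ → ℚ) → ℕ → Poly → ℚ
Ψ-aux B i [] = 0ℚ
Ψ-aux B i (a ∷ p) = (a ℚ.* B i) ℚ.+ Ψ-aux B (suc i) p

Ψ : (ℕ → ℚ) → Poly → ℚ
Ψ B p = Ψ-aux B 0 p

{-# OPTIONS --safe #-}
module Submission where

-- Write a_k = Ψ(P_k) for the polynomial P_k = C(x+2,2) C(−x−3+k,k) C(x+k,k) of the statement.
-- The defining relation of the Bernoulli numbers says exactly that Ψ((1+x)ⁿ) = B_n + [n = 1],
-- i.e. Ψ(p(x+1)) = Ψ(p(x)) + p′(0); so Ψ kills G(x+1) − G(x) whenever x² divides G.
-- For k ≥ 2 one has the polynomial identity
--   (2k+3) P_k − (2k−3) P_{k−1} = G(x+1) − G(x),   G = x² C(x+2,2) C(−x−3+k,k) C(x+k−1,k−1) / k,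
-- hence (2k+3) a_k = (2k−3) a_{k−1}, and a_k (2k+3)(2k+1)(2k−1) is the same for all k ≥ 1.
-- The cases k = 0, 1 are finite computations with B_0, …, B_4 = 1, −1/2, 1/6, 0, −1/30,
-- which the defining relation determines.

open import Defs
open import Data.Nat as ℕ using (ℕ; zero; suc; _∸_; _≤_; _<_; z≤n; s≤s; _!)
open import Data.Integer as ℤ using (ℤ; +_)
open import Data.Rational as ℚ using (ℚ; 1ℚ; 0ℚ; _/_)
open import Data.List using (List; []; _∷_; length)
open import Data.List.Relation.Unary.All using (All; []; _∷_)
open import Data.Sum using ([_,_]′)
open import Relation.Binary.PropositionalEquality
import Data.Nat.Properties as ℕP
import Data.Integer.Properties as ℤP
import Data.Rational.Properties as ℚP
import Data.Rational.Unnormalised as ℚᵘ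
import Data.Rational.Unnormalised.Properties as ℚᵘP
open import Algebra.Definitions.RawSemiring ℚP.+-*-rawSemiring using (_^_)
open import Algebra.Properties.Group ℚP.+-0-group using (∙-cancelˡ)
open import Data.Rational.Solver using (module +-*-Solver)
open +-*-Solver
open import Level using (0ℓ)
open import Relation.Nullary.Decidable.Core using (dec⇒maybe)
open import Tactic.RingSolver using (solve-∀)
open import Tactic.RingSolver.Core.AlmostCommutativeRing using (AlmostCommutativeRing; fromCommutativeRing)

toℚᵘ-ℤtoℚ : ∀ z → ℚ.toℚᵘ (ℤtoℚ z) ℚᵘ.≃ ℚᵘ.mkℚᵘ z 0
toℚᵘ-ℤtoℚ z = ℚP.toℚᵘ-fromℚᵘ (ℚᵘ.mkℚᵘ z 0)

ℤtoℚ-+ : ∀ a b → ℤtoℚ (a ℤ.+ b) ≡ ℤtoℚ a ℚ.+ ℤtoℚ b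
ℤtoℚ-+ a b = ℚP.toℚᵘ-injective (ℚᵘP.≃-trans (toℚᵘ-ℤtoℚ (a ℤ.+ b)) (ℚᵘP.≃-trans (ℚᵘ.*≡* cross)
  (ℚᵘP.≃-sym (ℚᵘP.≃-trans (ℚP.toℚᵘ-homo-+ (ℤtoℚ a) (ℤtoℚ b)) (ℚᵘP.+-cong (toℚᵘ-ℤtoℚ a) (toℚᵘ-ℤtoℚ b))))))
  where
  cross : (a ℤ.+ b) ℤ.* + 1 ≡ (a ℤ.* + 1 ℤ.+ b ℤ.* + 1) ℤ.* + 1
  cross = cong (ℤ._* + 1) (sym (cong₂ ℤ._+_ (ℤP.*-identityʳ a) (ℤP.*-identityʳ b)))

ℤtoℚ-* : ∀ a b → ℤtoℚ (a ℤ.* b) ≡ ℤtoℚ a ℚ.* ℤtoℚ b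
ℤtoℚ-* a b = ℚP.toℚᵘ-injective (ℚᵘP.≃-trans (toℚᵘ-ℤtoℚ (a ℤ.* b)) (ℚᵘP.≃-trans (ℚᵘ.*≡* refl)
  (ℚᵘP.≃-sym (ℚᵘP.≃-trans (ℚP.toℚᵘ-homo-* (ℤtoℚ a) (ℤtoℚ b)) (ℚᵘP.*-cong (toℚᵘ-ℤtoℚ a) (toℚᵘ-ℤtoℚ b))))))

ℤtoℚ-neg : ∀ a → ℤtoℚ (ℤ.- a) ≡ ℚ.- ℤtoℚ a
ℤtoℚ-neg a = ℚP.toℚᵘ-injective (ℚᵘP.≃-trans (toℚᵘ-ℤtoℚ (ℤ.- a))
  (ℚᵘP.≃-sym (ℚᵘP.≃-trans (ℚP.toℚᵘ-homo‿- (ℤtoℚ a)) (ℚᵘP.-‿cong (toℚᵘ-ℤtoℚ a)))))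

ℕtoℚ-+ : ∀ m n → ℕtoℚ (m ℕ.+ n) ≡ ℕtoℚ m ℚ.+ ℕtoℚ n
ℕtoℚ-+ m n = ℤtoℚ-+ (+ m) (+ n)

ℕtoℚ-* : ∀ m n → ℕtoℚ (m ℕ.* n) ≡ ℕtoℚ m ℚ.* ℕtoℚ n
ℕtoℚ-* m n = trans (cong ℤtoℚ (ℤP.pos-* m n)) (ℤtoℚ-* (+ m) (+ n))

ℕtoℚ-suc : ∀ n → ℕtoℚ (suc n) ≡ 1ℚ ℚ.+ ℕtoℚ n
ℕtoℚ-suc n = ℕtoℚ-+ 1 n

ℕtoℚ-suc-*-inverse : ∀ n → ℕtoℚ (suc n) ℚ.* ((+ 1) / suc n) ≡ 1ℚ
ℕtoℚ-suc-*-inverse n = ℚP.toℚᵘ-injective (ℚᵘP.≃-trans (ℚP.toℚᵘ-homo-* (ℕtoℚ (suc n)) ((+ 1) / suc n))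
  (ℚᵘP.≃-trans (ℚᵘP.*-cong (toℚᵘ-ℤtoℚ (+ suc n)) (ℚP.toℚᵘ-fromℚᵘ (ℚᵘ.mkℚᵘ (+ 1) n))) (ℚᵘ.*≡* cross)))
  where
  cross : (+ suc n ℤ.* + 1) ℤ.* + 1 ≡ + 1 ℤ.* (+ 1 ℤ.* + suc n)
  cross = cong +_ (trans (ℕP.*-identityʳ _) (trans (ℕP.*-identityʳ _)
    (sym (trans (ℕP.*-identityˡ _) (ℕP.*-identityˡ _)))))

invFact-suc : ∀ n → invFact n ≡ ℕtoℚ (suc n) ℚ.* invFact (suc n)
invFact-suc n = begin
  invFact n                                       ≡⟨ sym (ℚP.*-identityʳ (invFact n)) ⟩
  invFact n ℚ.* 1ℚ                                ≡⟨ cong (invFact n ℚ.*_) (sym (ℕtoℚ-suc-*-inverse n)) ⟩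
  invFact n ℚ.* (ℕtoℚ (suc n) ℚ.* ((+ 1) / suc n)) ≡⟨ solve 3 (λ u c i → u :* (c :* i) := c :* (u :* i)) refl (invFact n) (ℕtoℚ (suc n)) ((+ 1) / suc n) ⟩
  ℕtoℚ (suc n) ℚ.* invFact (suc n)                ∎
  where open ≡-Reasoning

!-*-invFact : ∀ n → ℕtoℚ (n !) ℚ.* invFact n ≡ 1ℚ
!-*-invFact zero = refl
!-*-invFact (suc n) = begin
  ℕtoℚ (suc n ℕ.* n !) ℚ.* invFact (suc n)           ≡⟨ cong (ℚ._* invFact (suc n)) (ℕtoℚ-* (suc n) (n !)) ⟩
  ℕtoℚ (suc n) ℚ.* ℕtoℚ (n !) ℚ.* invFact (suc n)    ≡⟨ solve 3 (λ c f u → c :* f :* u := f :* (c :* u)) refl (ℕtoℚ (suc n)) (ℕtoℚ (n !)) (invFact (suc n)) ⟩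
  ℕtoℚ (n !) ℚ.* (ℕtoℚ (suc n) ℚ.* invFact (suc n)) ≡⟨ cong (ℕtoℚ (n !) ℚ.*_) (sym (invFact-suc n)) ⟩
  ℕtoℚ (n !) ℚ.* invFact n                           ≡⟨ !-*-invFact n ⟩
  1ℚ                                                 ∎
  where open ≡-Reasoning

eval : Poly → ℚ → ℚ
eval [] x = 0ℚ
eval (a ∷ p) x = a ℚ.+ x ℚ.* eval p x

eval-+ₚ : ∀ p q x → eval (p +ₚ q) x ≡ eval p x ℚ.+ eval q x
eval-+ₚ [] q x = sym (ℚP.+-identityˡ _)
eval-+ₚ (a ∷ p) [] x = sym (ℚP.+-identityʳ _)
eval-+ₚ (a ∷ p) (b ∷ q) x = trans (cong (λ t → a ℚ.+ b ℚ.+ x ℚ.* t) (eval-+ₚ p q x))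
  (solve 5 (λ a b x u v → a :+ b :+ x :* (u :+ v) := a :+ x :* u :+ (b :+ x :* v)) refl a b x (eval p x) (eval q x))

eval-·ₚ : ∀ c p x → eval (c ·ₚ p) x ≡ c ℚ.* eval p x
eval-·ₚ c [] x = sym (ℚP.*-zeroʳ c)
eval-·ₚ c (a ∷ p) x = trans (cong (λ t → c ℚ.* a ℚ.+ x ℚ.* t) (eval-·ₚ c p x))
  (solve 4 (λ c a x u → c :* a :+ x :* (c :* u) := c :* (a :+ x :* u)) refl c a x (eval p x))

eval-*ₚ : ∀ p q x → eval (p *ₚ q) x ≡ eval p x ℚ.* eval q x
eval-*ₚ [] q x = sym (ℚP.*-zeroˡ (eval q x))
eval-*ₚ (a ∷ p) q x = trans (eval-+ₚ (a ·ₚ q) (0ℚ ∷ p *ₚ q) x)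
  (trans (cong₂ (λ s t → s ℚ.+ (0ℚ ℚ.+ x ℚ.* t)) (eval-·ₚ a q x) (eval-*ₚ p q x))
    (solve 4 (λ a x u v → a :* v :+ (con 0ℚ :+ x :* (u :* v)) := (a :+ x :* u) :* v) refl a x (eval p x) (eval q x)))

eval--ₚ : ∀ p q x → eval (p -ₚ q) x ≡ eval p x ℚ.- eval q x
eval--ₚ p q x = trans (eval-+ₚ p (-ₚ q) x) (cong (eval p x ℚ.+_)
  (trans (eval-·ₚ (ℚ.- 1ℚ) q x) (solve 1 (λ v → :- con 1ℚ :* v := :- v) refl (eval q x))))

eval-const : ∀ c x → eval (const c) x ≡ c
eval-const c x = solve 2 (λ c x → c :+ x :* con 0ℚ := c) refl c x

eval-X+const : ∀ c x → eval (X +ₚ const c) x ≡ x ℚ.+ c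
eval-X+const c x = solve 2 (λ c x → con 0ℚ :+ c :+ x :* (con 1ℚ :+ x :* con 0ℚ) := x :+ c) refl c x

falling : ℚ → ℕ → ℚ
falling y zero = 1ℚ
falling y (suc n) = falling y n ℚ.* (y ℚ.- ℕtoℚ n)

falling-suc : ∀ y n → falling y (suc n) ≡ y ℚ.* falling (y ℚ.- 1ℚ) n
falling-suc y zero = solve 1 (λ y → con 1ℚ :* (y :- con 0ℚ) := y :* con 1ℚ) refl y
falling-suc y (suc n) = begin
  falling y (suc n) ℚ.* (y ℚ.- ℕtoℚ (suc n))     ≡⟨ cong₂ (λ s t → s ℚ.* (y ℚ.- t)) (falling-suc y n) (ℕtoℚ-suc n) ⟩
  y ℚ.* F ℚ.* (y ℚ.- (1ℚ ℚ.+ ℕtoℚ n))            ≡⟨ solve 3 (λ y F n → y :* F :* (y :- (con 1ℚ :+ n)) := y :* (F :* (y :- con 1ℚ :- n))) refl y F (ℕtoℚ n) ⟩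
  y ℚ.* (F ℚ.* (y ℚ.- 1ℚ ℚ.- ℕtoℚ n))            ∎
  where open ≡-Reasoning
        F = falling (y ℚ.- 1ℚ) n

eval-fallingProd : ∀ p n x → eval (fallingProd p n) x ≡ falling (eval p x) n
eval-fallingProd p zero x = eval-const 1ℚ x
eval-fallingProd p (suc n) x = trans (eval-*ₚ (fallingProd p n) _ x) (cong₂ ℚ._*_ (eval-fallingProd p n x)
  (trans (eval--ₚ p (const (ℕtoℚ n)) x) (cong (λ c → eval p x ℚ.- c) (eval-const _ x))))

eval-choose : ∀ p n x → eval (choose p n) x ≡ invFact n ℚ.* falling (eval p x) n
eval-choose p n x = trans (eval-·ₚ (invFact n) (fallingProd p n) x) (cong (invFact n ℚ.*_) (eval-fallingProd p n x))

module _ (B : ℕ → ℚ) where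

  Ψ-aux-+ₚ : ∀ i p q → Ψ-aux B i (p +ₚ q) ≡ Ψ-aux B i p ℚ.+ Ψ-aux B i q
  Ψ-aux-+ₚ i [] q = sym (ℚP.+-identityˡ _)
  Ψ-aux-+ₚ i (a ∷ p) [] = sym (ℚP.+-identityʳ _)
  Ψ-aux-+ₚ i (a ∷ p) (b ∷ q) = trans (cong (λ t → (a ℚ.+ b) ℚ.* B i ℚ.+ t) (Ψ-aux-+ₚ (suc i) p q))
    (solve 5 (λ a b β u v → (a :+ b) :* β :+ (u :+ v) := a :* β :+ u :+ (b :* β :+ v)) refl
      a b (B i) (Ψ-aux B (suc i) p) (Ψ-aux B (suc i) q))

  Ψ-aux-·ₚ : ∀ i c p → Ψ-aux B i (c ·ₚ p) ≡ c ℚ.* Ψ-aux B i p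
  Ψ-aux-·ₚ i c [] = sym (ℚP.*-zeroʳ c)
  Ψ-aux-·ₚ i c (a ∷ p) = trans (cong (λ t → c ℚ.* a ℚ.* B i ℚ.+ t) (Ψ-aux-·ₚ (suc i) c p))
    (solve 4 (λ c a β u → c :* a :* β :+ c :* u := c :* (a :* β :+ u)) refl c a (B i) (Ψ-aux B (suc i) p))

  Ψ-aux-zero : ∀ i p → All (_≡ 0ℚ) p → Ψ-aux B i p ≡ 0ℚ
  Ψ-aux-zero i [] [] = refl
  Ψ-aux-zero i (a ∷ p) (a≡0 ∷ p≡0) = trans (cong₂ (λ s t → s ℚ.* B i ℚ.+ t) a≡0 (Ψ-aux-zero (suc i) p p≡0))
    (solve 1 (λ β → con 0ℚ :* β :+ con 0ℚ := con 0ℚ) refl (B i))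

-- A polynomial vanishing on ℕ has zero coefficients

*-cancelˡ-invertible : ∀ {c d} → c ℚ.* d ≡ 1ℚ → ∀ {p q} → c ℚ.* p ≡ c ℚ.* q → p ≡ q
*-cancelˡ-invertible {c} {d} cd≡1 {p} {q} cp≡cq = begin
  p                 ≡⟨ sym (ℚP.*-identityˡ p) ⟩
  1ℚ ℚ.* p          ≡⟨ cong (ℚ._* p) (sym cd≡1) ⟩
  c ℚ.* d ℚ.* p     ≡⟨ solve 3 (λ c d p → c :* d :* p := d :* (c :* p)) refl c d p ⟩
  d ℚ.* (c ℚ.* p)   ≡⟨ cong (d ℚ.*_) cp≡cq ⟩
  d ℚ.* (c ℚ.* q)   ≡⟨ solve 3 (λ c d q → d :* (c :* q) := c :* d :* q) refl c d q ⟩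
  c ℚ.* d ℚ.* q     ≡⟨ cong (ℚ._* q) cd≡1 ⟩
  1ℚ ℚ.* q          ≡⟨ ℚP.*-identityˡ q ⟩
  q                 ∎
  where open ≡-Reasoning

divide : ℚ → Poly → Poly
divide r [] = []
divide r (a ∷ []) = []
divide r (a ∷ b ∷ p) = eval (b ∷ p) r ∷ divide r (b ∷ p)

eval-divide : ∀ r p x → eval p x ≡ (x ℚ.- r) ℚ.* eval (divide r p) x ℚ.+ eval p r
eval-divide r [] x = solve 2 (λ x r → con 0ℚ := (x :- r) :* con 0ℚ :+ con 0ℚ) refl x r
eval-divide r (a ∷ []) x = solve 3 (λ a x r → a :+ x :* con 0ℚ := (x :- r) :* con 0ℚ :+ (a :+ r :* con 0ℚ)) refl a x r
eval-divide r (a ∷ b ∷ p) x = trans (cong (λ t → a ℚ.+ x ℚ.* t) (eval-divide r (b ∷ p) x))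
  (solve 5 (λ a x r u v → a :+ x :* ((x :- r) :* u :+ v) := (x :- r) :* (v :+ x :* u) :+ (a :+ r :* v))
    refl a x r (eval (divide r (b ∷ p)) x) (eval (b ∷ p) r))

length-divide : ∀ r a p → length (divide r (a ∷ p)) ≡ length p
length-divide r a [] = refl
length-divide r a (b ∷ p) = cong suc (length-divide r b p)

root∧divide-zero⇒zero : ∀ r p → eval p r ≡ 0ℚ → All (_≡ 0ℚ) (divide r p) → All (_≡ 0ℚ) p
root∧divide-zero⇒zero r [] _ [] = []
root∧divide-zero⇒zero r (a ∷ []) pr≡0 [] =
  trans (solve 2 (λ a r → a := a :+ r :* con 0ℚ) refl a r) pr≡0 ∷ []
root∧divide-zero⇒zero r (a ∷ b ∷ p) pr≡0 (qr≡0 ∷ rest≡0) =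
  trans (solve 2 (λ a r → a := a :+ r :* con 0ℚ) refl a r) (trans (cong (λ t → a ℚ.+ r ℚ.* t) (sym qr≡0)) pr≡0)
  ∷ root∧divide-zero⇒zero r (b ∷ p) qr≡0 rest≡0

vanishing-on-ℕ⇒zero : ∀ ℓ p → length p ≡ ℓ → ∀ m →
                      (∀ n → eval p (ℕtoℚ (m ℕ.+ n)) ≡ 0ℚ) → All (_≡ 0ℚ) p
vanishing-on-ℕ⇒zero _ [] _ _ _ = []
vanishing-on-ℕ⇒zero (suc ℓ) (a ∷ p) |p|≡ℓ m p-vanishes =
  root∧divide-zero⇒zero r (a ∷ p) root
    (vanishing-on-ℕ⇒zero ℓ (divide r (a ∷ p)) (trans (length-divide r a p) (ℕP.suc-injective |p|≡ℓ))
      (suc m) q-vanishes)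
  where
  r = ℕtoℚ m
  root : eval (a ∷ p) r ≡ 0ℚ
  root = subst (λ t → eval (a ∷ p) (ℕtoℚ t) ≡ 0ℚ) (ℕP.+-identityʳ m) (p-vanishes 0)
  q-vanishes : ∀ n → eval (divide r (a ∷ p)) (ℕtoℚ (suc m ℕ.+ n)) ≡ 0ℚ
  q-vanishes n = *-cancelˡ-invertible {ℕtoℚ (suc n)} (ℕtoℚ-suc-*-inverse n) (begin
    ℕtoℚ (suc n) ℚ.* Q                    ≡⟨ cong (ℚ._* Q) (solve 2 (λ r c → c := r :+ c :- r) refl r (ℕtoℚ (suc n))) ⟩
    (r ℚ.+ ℕtoℚ (suc n) ℚ.- r) ℚ.* Q      ≡⟨ cong (λ y → (y ℚ.- r) ℚ.* Q) x≡r+n+1 ⟨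
    (x ℚ.- r) ℚ.* Q                       ≡⟨ solve 1 (λ u → u := u :+ con 0ℚ) refl ((x ℚ.- r) ℚ.* Q) ⟩
    (x ℚ.- r) ℚ.* Q ℚ.+ 0ℚ                ≡⟨ cong (λ t → (x ℚ.- r) ℚ.* Q ℚ.+ t) root ⟨
    (x ℚ.- r) ℚ.* Q ℚ.+ eval (a ∷ p) r    ≡⟨ eval-divide r (a ∷ p) x ⟨
    eval (a ∷ p) x                        ≡⟨ subst (λ t → eval (a ∷ p) (ℕtoℚ t) ≡ 0ℚ) (ℕP.+-suc m n) (p-vanishes (suc n)) ⟩
    0ℚ                                    ≡⟨ ℚP.*-zeroʳ (ℕtoℚ (suc n)) ⟨
    ℕtoℚ (suc n) ℚ.* 0ℚ                   ∎)
    where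
    open ≡-Reasoning
    x = ℕtoℚ (suc m ℕ.+ n)
    Q = eval (divide r (a ∷ p)) x
    x≡r+n+1 : x ≡ r ℚ.+ ℕtoℚ (suc n)
    x≡r+n+1 = trans (cong ℕtoℚ (sym (ℕP.+-suc m n))) (ℕtoℚ-+ m (suc n))

module _ (B : ℕ → ℚ) where

  Ψ--ₚ : ∀ p q → Ψ B (p -ₚ q) ≡ Ψ B p ℚ.- Ψ B q
  Ψ--ₚ p q = trans (Ψ-aux-+ₚ B 0 p (-ₚ q)) (cong (Ψ B p ℚ.+_)
    (trans (Ψ-aux-·ₚ B 0 (ℚ.- 1ℚ) q) (solve 1 (λ v → :- con 1ℚ :* v := :- v) refl (Ψ B q))))

  Ψ-cong-eval : ∀ p q → (∀ n → eval p (ℕtoℚ n) ≡ eval q (ℕtoℚ n)) → Ψ B p ≡ Ψ B q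
  Ψ-cong-eval p q p≗q = begin
    Ψ B p                           ≡⟨ solve 2 (λ u v → u := u :- v :+ v) refl (Ψ B p) (Ψ B q) ⟩
    Ψ B p ℚ.- Ψ B q ℚ.+ Ψ B q       ≡⟨ cong (ℚ._+ Ψ B q) (Ψ--ₚ p q) ⟨
    Ψ B (p -ₚ q) ℚ.+ Ψ B q          ≡⟨ cong (ℚ._+ Ψ B q) (Ψ-aux-zero B 0 (p -ₚ q) (vanishing-on-ℕ⇒zero _ (p -ₚ q) refl 0 p-q-vanishes)) ⟩
    0ℚ ℚ.+ Ψ B q                    ≡⟨ ℚP.+-identityˡ (Ψ B q) ⟩
    Ψ B q                           ∎
    where
    open ≡-Reasoning
    p-q-vanishes : ∀ n → eval (p -ₚ q) (ℕtoℚ n) ≡ 0ℚ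
    p-q-vanishes n = trans (eval--ₚ p q _) (trans (cong (λ t → t ℚ.- eval q (ℕtoℚ n)) (p≗q n))
      (ℚP.+-inverseʳ (eval q (ℕtoℚ n))))

-- The shift p(x) ↦ p(x+1) under Ψ

-- binomialRow a b lists 1/((a+j)! (b−j)!) for j = 0, …, b, so binomialRow 0 n holds the
-- coefficients of (1+x)ⁿ/n!, and Ψ of it is the sum in the Bernoulli relation.
mutual
  binomialRow : ℕ → ℕ → Poly
  binomialRow a b = invFact a ℚ.* invFact b ∷ binomialRowTail a b

  binomialRowTail : ℕ → ℕ → Poly
  binomialRowTail a zero = []
  binomialRowTail a (suc b) = binomialRow (suc a) b

binomialRow-pascal : ∀ a b → ℕtoℚ (suc (a ℕ.+ b)) ·ₚ binomialRow (suc a) b ≡ binomialRowTail a b +ₚ binomialRow a b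
binomialRow-pascal a zero = cong (_∷ []) (begin
  ℕtoℚ (suc (a ℕ.+ 0)) ℚ.* (invFact (suc a) ℚ.* 1ℚ)  ≡⟨ cong (λ t → ℕtoℚ (suc t) ℚ.* (invFact (suc a) ℚ.* 1ℚ)) (ℕP.+-identityʳ a) ⟩
  ℕtoℚ (suc a) ℚ.* (invFact (suc a) ℚ.* 1ℚ)          ≡⟨ solve 2 (λ c u → c :* (u :* con 1ℚ) := c :* u :* con 1ℚ) refl (ℕtoℚ (suc a)) (invFact (suc a)) ⟩
  ℕtoℚ (suc a) ℚ.* invFact (suc a) ℚ.* 1ℚ            ≡⟨ cong (ℚ._* 1ℚ) (invFact-suc a) ⟨
  invFact a ℚ.* 1ℚ                                   ∎)
  where open ≡-Reasoning
binomialRow-pascal a (suc b) = cong₂ _∷_ head-pascal (trans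
  (cong (λ t → ℕtoℚ (suc t) ·ₚ binomialRow (suc (suc a)) b) (ℕP.+-suc a b)) (binomialRow-pascal (suc a) b))
  where
  open ≡-Reasoning
  α = ℕtoℚ a
  β = ℕtoℚ b
  u = invFact (suc a)
  v = invFact (suc b)
  c≡2+α+β : ℕtoℚ (suc (a ℕ.+ suc b)) ≡ 1ℚ ℚ.+ (α ℚ.+ (1ℚ ℚ.+ β))
  c≡2+α+β = trans (ℕtoℚ-suc (a ℕ.+ suc b)) (cong (1ℚ ℚ.+_) (trans (ℕtoℚ-+ a (suc b)) (cong (α ℚ.+_) (ℕtoℚ-suc b))))
  head-pascal : ℕtoℚ (suc (a ℕ.+ suc b)) ℚ.* (u ℚ.* v) ≡ u ℚ.* invFact b ℚ.+ invFact a ℚ.* v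
  head-pascal = begin
    ℕtoℚ (suc (a ℕ.+ suc b)) ℚ.* (u ℚ.* v)                     ≡⟨ cong (ℚ._* (u ℚ.* v)) c≡2+α+β ⟩
    (1ℚ ℚ.+ (α ℚ.+ (1ℚ ℚ.+ β))) ℚ.* (u ℚ.* v)                  ≡⟨ solve 4 (λ α β u v → (con 1ℚ :+ (α :+ (con 1ℚ :+ β))) :* (u :* v)
                                                                        := u :* ((con 1ℚ :+ β) :* v) :+ (con 1ℚ :+ α) :* u :* v) refl α β u v ⟩
    u ℚ.* ((1ℚ ℚ.+ β) ℚ.* v) ℚ.+ (1ℚ ℚ.+ α) ℚ.* u ℚ.* v        ≡⟨ cong₂ (λ s t → u ℚ.* (s ℚ.* v) ℚ.+ t ℚ.* u ℚ.* v) (ℕtoℚ-suc b) (ℕtoℚ-suc a) ⟨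
    u ℚ.* (ℕtoℚ (suc b) ℚ.* v) ℚ.+ ℕtoℚ (suc a) ℚ.* u ℚ.* v    ≡⟨ cong₂ (λ s t → u ℚ.* s ℚ.+ t ℚ.* v) (invFact-suc b) (invFact-suc a) ⟨
    u ℚ.* invFact b ℚ.+ invFact a ℚ.* v                        ∎

binomialPoly : ℕ → Poly
binomialPoly n = ℕtoℚ (n !) ·ₚ binomialRow 0 n

eval-binomialRow-suc : ∀ n x → ℕtoℚ (suc n) ℚ.* eval (binomialRow 0 (suc n)) x ≡ (1ℚ ℚ.+ x) ℚ.* eval (binomialRow 0 n) x
eval-binomialRow-suc n x = begin
  ℕtoℚ (suc n) ℚ.* eval (binomialRow 0 (suc n)) x       ≡⟨ eval-·ₚ (ℕtoℚ (suc n)) (binomialRow 0 (suc n)) x ⟨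
  eval (ℕtoℚ (suc n) ·ₚ binomialRow 0 (suc n)) x        ≡⟨ cong (λ p → eval p x) row-recurrence ⟩
  eval (binomialRow 0 n +ₚ (0ℚ ∷ binomialRow 0 n)) x    ≡⟨ eval-+ₚ (binomialRow 0 n) (0ℚ ∷ binomialRow 0 n) x ⟩
  E ℚ.+ (0ℚ ℚ.+ x ℚ.* E)                                ≡⟨ solve 2 (λ x E → E :+ (con 0ℚ :+ x :* E) := (con 1ℚ :+ x) :* E) refl x E ⟩
  (1ℚ ℚ.+ x) ℚ.* E                                      ∎
  where
  open ≡-Reasoning
  E = eval (binomialRow 0 n) x
  head : ℕtoℚ (suc n) ℚ.* (1ℚ ℚ.* invFact (suc n)) ≡ 1ℚ ℚ.* invFact n ℚ.+ 0ℚ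
  head = trans (solve 2 (λ c u → c :* (con 1ℚ :* u) := con 1ℚ :* (c :* u) :+ con 0ℚ) refl (ℕtoℚ (suc n)) (invFact (suc n)))
    (cong (λ t → 1ℚ ℚ.* t ℚ.+ 0ℚ) (sym (invFact-suc n)))
  row-recurrence : ℕtoℚ (suc n) ·ₚ binomialRow 0 (suc n) ≡ binomialRow 0 n +ₚ (0ℚ ∷ binomialRow 0 n)
  row-recurrence = cong₂ _∷_ head (binomialRow-pascal 0 n)

eval-binomialPoly : ∀ n x → eval (binomialPoly n) x ≡ (1ℚ ℚ.+ x) ^ n
eval-binomialPoly zero x = solve 1 (λ x → con 1ℚ :* (con 1ℚ :* con 1ℚ) :+ x :* con 0ℚ := con 1ℚ) refl x
eval-binomialPoly (suc n) x = begin
  eval (binomialPoly (suc n)) x                      ≡⟨ eval-·ₚ (ℕtoℚ (suc n !)) (binomialRow 0 (suc n)) x ⟩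
  ℕtoℚ (suc n ℕ.* n !) ℚ.* E′                        ≡⟨ cong (ℚ._* E′) (ℕtoℚ-* (suc n) (n !)) ⟩
  ℕtoℚ (suc n) ℚ.* ℕtoℚ (n !) ℚ.* E′                 ≡⟨ solve 3 (λ c f e → c :* f :* e := f :* (c :* e)) refl (ℕtoℚ (suc n)) (ℕtoℚ (n !)) E′ ⟩
  ℕtoℚ (n !) ℚ.* (ℕtoℚ (suc n) ℚ.* E′)               ≡⟨ cong (ℕtoℚ (n !) ℚ.*_) (eval-binomialRow-suc n x) ⟩
  ℕtoℚ (n !) ℚ.* ((1ℚ ℚ.+ x) ℚ.* E)                  ≡⟨ solve 3 (λ f y e → f :* (y :* e) := y :* (f :* e)) refl (ℕtoℚ (n !)) (1ℚ ℚ.+ x) E ⟩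
  (1ℚ ℚ.+ x) ℚ.* (ℕtoℚ (n !) ℚ.* E)                  ≡⟨ cong ((1ℚ ℚ.+ x) ℚ.*_) (eval-·ₚ (ℕtoℚ (n !)) (binomialRow 0 n) x) ⟨
  (1ℚ ℚ.+ x) ℚ.* eval (binomialPoly n) x             ≡⟨ cong ((1ℚ ℚ.+ x) ℚ.*_) (eval-binomialPoly n x) ⟩
  (1ℚ ℚ.+ x) ^ suc n                                 ∎
  where
  open ≡-Reasoning
  E = eval (binomialRow 0 n) x
  E′ = eval (binomialRow 0 (suc n)) x

sumTo-suc : ∀ n f → sumTo (suc n) f ≡ f 0 ℚ.+ sumTo n (λ j → f (suc j))
sumTo-suc zero f = refl
sumTo-suc (suc n) f = trans (cong (ℚ._+ f (suc (suc n))) (sumTo-suc n f))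
  (ℚP.+-assoc (f 0) (sumTo n (λ j → f (suc j))) (f (suc (suc n))))

sumTo-cong : ∀ n f g → (∀ j → j ≤ n → f j ≡ g j) → sumTo n f ≡ sumTo n g
sumTo-cong zero f g f≗g = f≗g 0 z≤n
sumTo-cong (suc n) f g f≗g =
  cong₂ ℚ._+_ (sumTo-cong n f g (λ j j≤n → f≗g j (ℕP.m≤n⇒m≤1+n j≤n))) (f≗g (suc n) ℕP.≤-refl)

BernoulliRelation : (ℕ → ℚ) → ℕ → Set
BernoulliRelation B n = sumTo n (λ j → (B j ℚ.* invFact j) ℚ.* invFact (suc (n ∸ j))) ≡ kronecker0 n

suc!-*-kronecker0 : ∀ n → ℕtoℚ (suc n !) ℚ.* kronecker0 n ≡ kronecker0 n
suc!-*-kronecker0 zero = refl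
suc!-*-kronecker0 (suc n) = ℚP.*-zeroʳ (ℕtoℚ (suc (suc n) !))

module _ (B : ℕ → ℚ) where

  Ψ-aux-binomialRow : ∀ a b → Ψ-aux B a (binomialRow a b) ≡ sumTo b (λ j → (B (a ℕ.+ j) ℚ.* invFact (a ℕ.+ j)) ℚ.* invFact (b ∸ j))
  Ψ-aux-binomialRow a zero = trans (solve 2 (λ u β → u :* con 1ℚ :* β :+ con 0ℚ := β :* u :* con 1ℚ) refl (invFact a) (B a))
    (cong (λ t → (B t ℚ.* invFact t) ℚ.* 1ℚ) (sym (ℕP.+-identityʳ a)))
  Ψ-aux-binomialRow a (suc b) = sym (begin
    sumTo (suc b) f                                      ≡⟨ sumTo-suc b f ⟩
    f 0 ℚ.+ sumTo b (λ j → f (suc j))                    ≡⟨ cong₂ ℚ._+_ (cong (λ t → (B t ℚ.* invFact t) ℚ.* invFact (suc b)) (ℕP.+-identityʳ a))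
                                                              (sumTo-cong b _ _ (λ j _ → cong (λ t → (B t ℚ.* invFact t) ℚ.* invFact (b ∸ j)) (ℕP.+-suc a j))) ⟩
    B a ℚ.* invFact a ℚ.* invFact (suc b) ℚ.+ sumTo b g  ≡⟨ cong₂ ℚ._+_ (solve 3 (λ β u v → β :* u :* v := u :* v :* β) refl (B a) (invFact a) (invFact (suc b)))
                                                              (sym (Ψ-aux-binomialRow (suc a) b)) ⟩
    invFact a ℚ.* invFact (suc b) ℚ.* B a ℚ.+ Ψ-aux B (suc a) (binomialRow (suc a) b) ∎)
    where
    open ≡-Reasoning
    f = λ j → (B (a ℕ.+ j) ℚ.* invFact (a ℕ.+ j)) ℚ.* invFact (suc b ∸ j)
    g = λ j → (B (suc a ℕ.+ j) ℚ.* invFact (suc a ℕ.+ j)) ℚ.* invFact (b ∸ j)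

  Ψ-binomialPoly-zero : Ψ B (binomialPoly 0) ≡ B 0
  Ψ-binomialPoly-zero = solve 1 (λ β → con 1ℚ :* (con 1ℚ :* con 1ℚ) :* β :+ con 0ℚ := β) refl (B 0)

  Ψ-binomialPoly-suc : ∀ n → BernoulliRelation B n → Ψ B (binomialPoly (suc n)) ≡ B (suc n) ℚ.+ kronecker0 n
  Ψ-binomialPoly-suc n relation = begin
    Ψ B (ℕtoℚ (suc n !) ·ₚ binomialRow 0 (suc n))        ≡⟨ Ψ-aux-·ₚ B 0 (ℕtoℚ (suc n !)) (binomialRow 0 (suc n)) ⟩
    F ℚ.* Ψ B (binomialRow 0 (suc n))                    ≡⟨ cong (F ℚ.*_) (trans (Ψ-aux-binomialRow 0 (suc n)) (sumTo-suc-last)) ⟩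
    F ℚ.* (kronecker0 n ℚ.+ B (suc n) ℚ.* invFact (suc n) ℚ.* 1ℚ)
        ≡⟨ solve 4 (λ F δ β u → F :* (δ :+ β :* u :* con 1ℚ) := F :* δ :+ β :* (F :* u)) refl F (kronecker0 n) (B (suc n)) (invFact (suc n)) ⟩
    F ℚ.* kronecker0 n ℚ.+ B (suc n) ℚ.* (F ℚ.* invFact (suc n))
        ≡⟨ cong₂ (λ s t → s ℚ.+ B (suc n) ℚ.* t) (suc!-*-kronecker0 n) (!-*-invFact (suc n)) ⟩
    kronecker0 n ℚ.+ B (suc n) ℚ.* 1ℚ                    ≡⟨ solve 2 (λ δ β → δ :+ β :* con 1ℚ := β :+ δ) refl (kronecker0 n) (B (suc n)) ⟩
    B (suc n) ℚ.+ kronecker0 n                           ∎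
    where
    open ≡-Reasoning
    F = ℕtoℚ (suc n !)
    sumTo-suc-last : sumTo (suc n) (λ j → (B j ℚ.* invFact j) ℚ.* invFact (suc n ∸ j))
                   ≡ kronecker0 n ℚ.+ B (suc n) ℚ.* invFact (suc n) ℚ.* 1ℚ
    sumTo-suc-last = cong₂ ℚ._+_
      (trans (sumTo-cong n _ _ (λ j j≤n → cong (λ t → (B j ℚ.* invFact j) ℚ.* invFact t) (ℕP.+-∸-assoc 1 j≤n))) relation)
      (cong (λ t → (B (suc n) ℚ.* invFact (suc n)) ℚ.* invFact t) (ℕP.n∸n≡0 n))

shiftFrom : ℕ → Poly → Poly
shiftFrom i [] = []
shiftFrom i (a ∷ p) = a ·ₚ binomialPoly i +ₚ shiftFrom (suc i) p

shift : Poly → Poly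
shift = shiftFrom 0

eval-shiftFrom : ∀ i p x → eval (shiftFrom i p) x ≡ (1ℚ ℚ.+ x) ^ i ℚ.* eval p (1ℚ ℚ.+ x)
eval-shiftFrom i [] x = sym (ℚP.*-zeroʳ ((1ℚ ℚ.+ x) ^ i))
eval-shiftFrom i (a ∷ p) x = begin
  eval (a ·ₚ binomialPoly i +ₚ shiftFrom (suc i) p) x         ≡⟨ eval-+ₚ (a ·ₚ binomialPoly i) (shiftFrom (suc i) p) x ⟩
  eval (a ·ₚ binomialPoly i) x ℚ.+ eval (shiftFrom (suc i) p) x
      ≡⟨ cong₂ ℚ._+_ (trans (eval-·ₚ a (binomialPoly i) x) (cong (a ℚ.*_) (eval-binomialPoly i x))) (eval-shiftFrom (suc i) p x) ⟩
  a ℚ.* y ^ i ℚ.+ y ℚ.* y ^ i ℚ.* eval p y                    ≡⟨ solve 4 (λ a y z e → a :* z :+ y :* z :* e := z :* (a :+ y :* e)) refl a y (y ^ i) (eval p y) ⟩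
  y ^ i ℚ.* (a ℚ.+ y ℚ.* eval p y)                            ∎
  where
  open ≡-Reasoning
  y = 1ℚ ℚ.+ x

eval-shift : ∀ p x → eval (shift p) x ≡ eval p (1ℚ ℚ.+ x)
eval-shift p x = trans (eval-shiftFrom 0 p x) (ℚP.*-identityˡ (eval p (1ℚ ℚ.+ x)))

linearCoeff : Poly → ℚ
linearCoeff (_ ∷ b ∷ _) = b
linearCoeff _ = 0ℚ

module _ (B : ℕ → ℚ) (isBernoulli : IsBernoulli B) where

  Ψ-shiftFrom-2+ : ∀ i p → Ψ B (shiftFrom (2 ℕ.+ i) p) ≡ Ψ-aux B (2 ℕ.+ i) p
  Ψ-shiftFrom-2+ i [] = refl
  Ψ-shiftFrom-2+ i (a ∷ p) = begin
    Ψ B (a ·ₚ binomialPoly (2 ℕ.+ i) +ₚ shiftFrom (3 ℕ.+ i) p)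
        ≡⟨ Ψ-aux-+ₚ B 0 (a ·ₚ binomialPoly (2 ℕ.+ i)) (shiftFrom (3 ℕ.+ i) p) ⟩
    Ψ B (a ·ₚ binomialPoly (2 ℕ.+ i)) ℚ.+ Ψ B (shiftFrom (3 ℕ.+ i) p)
        ≡⟨ cong₂ ℚ._+_ (trans (Ψ-aux-·ₚ B 0 a (binomialPoly (2 ℕ.+ i)))
                               (cong (a ℚ.*_) (Ψ-binomialPoly-suc B (suc i) (isBernoulli (suc i)))))
                        (Ψ-shiftFrom-2+ (suc i) p) ⟩
    a ℚ.* (B (2 ℕ.+ i) ℚ.+ 0ℚ) ℚ.+ Ψ-aux B (3 ℕ.+ i) p
        ≡⟨ cong (λ t → a ℚ.* t ℚ.+ Ψ-aux B (3 ℕ.+ i) p) (ℚP.+-identityʳ (B (2 ℕ.+ i))) ⟩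
    a ℚ.* B (2 ℕ.+ i) ℚ.+ Ψ-aux B (3 ℕ.+ i) p                ∎
    where open ≡-Reasoning

  Ψ-shift : ∀ p → Ψ B (shift p) ≡ Ψ B p ℚ.+ linearCoeff p
  Ψ-shift [] = sym (ℚP.+-identityʳ 0ℚ)
  Ψ-shift (a ∷ []) = begin
    Ψ B (a ·ₚ binomialPoly 0 +ₚ [])          ≡⟨ Ψ-aux-+ₚ B 0 (a ·ₚ binomialPoly 0) [] ⟩
    Ψ B (a ·ₚ binomialPoly 0) ℚ.+ 0ℚ         ≡⟨ cong (ℚ._+ 0ℚ) (trans (Ψ-aux-·ₚ B 0 a (binomialPoly 0)) (cong (a ℚ.*_) (Ψ-binomialPoly-zero B))) ⟩
    a ℚ.* B 0 ℚ.+ 0ℚ                         ≡⟨ solve 2 (λ a β → a :* β :+ con 0ℚ := a :* β :+ con 0ℚ :+ con 0ℚ) refl a (B 0) ⟩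
    a ℚ.* B 0 ℚ.+ 0ℚ ℚ.+ 0ℚ                  ∎
    where open ≡-Reasoning
  Ψ-shift (a ∷ b ∷ p) = begin
    Ψ B (a ·ₚ binomialPoly 0 +ₚ (b ·ₚ binomialPoly 1 +ₚ shiftFrom 2 p))
        ≡⟨ Ψ-aux-+ₚ B 0 (a ·ₚ binomialPoly 0) (b ·ₚ binomialPoly 1 +ₚ shiftFrom 2 p) ⟩
    Ψ B (a ·ₚ binomialPoly 0) ℚ.+ Ψ B (b ·ₚ binomialPoly 1 +ₚ shiftFrom 2 p)
        ≡⟨ cong (Ψ B (a ·ₚ binomialPoly 0) ℚ.+_) (Ψ-aux-+ₚ B 0 (b ·ₚ binomialPoly 1) (shiftFrom 2 p)) ⟩
    Ψ B (a ·ₚ binomialPoly 0) ℚ.+ (Ψ B (b ·ₚ binomialPoly 1) ℚ.+ Ψ B (shiftFrom 2 p))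
        ≡⟨ cong₂ (λ s t → s ℚ.+ (t ℚ.+ Ψ B (shiftFrom 2 p)))
             (trans (Ψ-aux-·ₚ B 0 a (binomialPoly 0)) (cong (a ℚ.*_) (Ψ-binomialPoly-zero B)))
             (trans (Ψ-aux-·ₚ B 0 b (binomialPoly 1)) (cong (b ℚ.*_) (Ψ-binomialPoly-suc B 0 (isBernoulli 0)))) ⟩
    a ℚ.* B 0 ℚ.+ (b ℚ.* (B 1 ℚ.+ 1ℚ) ℚ.+ Ψ B (shiftFrom 2 p))
        ≡⟨ cong (λ t → a ℚ.* B 0 ℚ.+ (b ℚ.* (B 1 ℚ.+ 1ℚ) ℚ.+ t)) (Ψ-shiftFrom-2+ 0 p) ⟩
    a ℚ.* B 0 ℚ.+ (b ℚ.* (B 1 ℚ.+ 1ℚ) ℚ.+ Ψ-aux B 2 p)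
        ≡⟨ solve 5 (λ a b β₀ β₁ t → a :* β₀ :+ (b :* (β₁ :+ con 1ℚ) :+ t) := a :* β₀ :+ (b :* β₁ :+ t) :+ b) refl a b (B 0) (B 1) (Ψ-aux B 2 p) ⟩
    Ψ B (a ∷ b ∷ p) ℚ.+ b                                     ∎
    where open ≡-Reasoning

-- The Bernoulli relation determines B

module _ {B B′ : ℕ → ℚ} where

  Ψ-aux-cong : ∀ i p → (∀ j → j < i ℕ.+ length p → B j ≡ B′ j) → Ψ-aux B i p ≡ Ψ-aux B′ i p
  Ψ-aux-cong i [] _ = refl
  Ψ-aux-cong i (a ∷ p) agree = cong₂ (λ s t → a ℚ.* s ℚ.+ t)
    (agree i (ℕP.m<m+n i (s≤s z≤n)))
    (Ψ-aux-cong (suc i) p (λ j j< → agree j (subst (j <_) (sym (ℕP.+-suc i (length p))) j<)))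

  last-term-cancel : ∀ n → B n ℚ.* invFact n ℚ.* invFact (suc (n ∸ n)) ≡ B′ n ℚ.* invFact n ℚ.* invFact (suc (n ∸ n)) →
                     B n ≡ B′ n
  last-term-cancel n eq rewrite ℕP.n∸n≡0 n =
    *-cancelˡ-invertible {invFact n} (trans (ℚP.*-comm (invFact n) (ℕtoℚ (n !))) (!-*-invFact n)) (begin
      invFact n ℚ.* B n             ≡⟨ solve 2 (λ u β → u :* β := β :* u :* con (invFact 1)) refl (invFact n) (B n) ⟩
      B n ℚ.* invFact n ℚ.* invFact 1    ≡⟨ eq ⟩
      B′ n ℚ.* invFact n ℚ.* invFact 1   ≡⟨ solve 2 (λ u β → β :* u :* con (invFact 1) := u :* β) refl (invFact n) (B′ n) ⟩
      invFact n ℚ.* B′ n            ∎)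
    where open ≡-Reasoning

  relation-determines-next : ∀ n → (∀ j → j < n → B j ≡ B′ j) →
                             BernoulliRelation B n → BernoulliRelation B′ n → B n ≡ B′ n
  relation-determines-next zero _ relation relation′ = last-term-cancel 0 (trans relation (sym relation′))
  relation-determines-next (suc n) agree relation relation′ = last-term-cancel (suc n)
    (∙-cancelˡ (sumTo n (term B)) _ _ (trans relation (trans (sym relation′) (cong (ℚ._+ _) (sym earlier-terms-agree)))))
    where
    term : (ℕ → ℚ) → ℕ → ℚ
    term b j = (b j ℚ.* invFact j) ℚ.* invFact (suc (suc n ∸ j))
    earlier-terms-agree : sumTo n (term B) ≡ sumTo n (term B′)
    earlier-terms-agree = sumTo-cong n _ _ (λ j j≤n → cong (λ t → (t ℚ.* invFact j) ℚ.* invFact (suc (suc n ∸ j))) (agree j (s≤s j≤n)))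

  bernoulli-unique : ∀ N → (∀ n → n < N → BernoulliRelation B n) → (∀ n → n < N → BernoulliRelation B′ n) →
                     ∀ j → j < N → B j ≡ B′ j
  bernoulli-unique zero _ _ _ ()
  bernoulli-unique (suc N) relations relations′ j j<1+N =
    [ agree-below-N j
    , (λ j≡N → subst (λ i → B i ≡ B′ i) (sym j≡N)
                 (relation-determines-next N agree-below-N (relations N ℕP.≤-refl) (relations′ N ℕP.≤-refl)))
    ]′ (ℕP.m<1+n⇒m<n∨m≡n j<1+N)
    where
    agree-below-N : ∀ i → i < N → B i ≡ B′ i
    agree-below-N = bernoulli-unique N (λ n n<N → relations n (ℕP.m<n⇒m<1+n n<N))
                                       (λ n n<N → relations′ n (ℕP.m<n⇒m<1+n n<N))

-- The recurrence for Ψ(P_k)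

C₂ : Poly
C₂ = choose (X +ₚ const (ℕtoℚ 2)) 2

N : ℕ → Poly
N k = choose ((-ₚ X) -ₚ const (ℕtoℚ 3) +ₚ const (ℕtoℚ k)) k

M : ℕ → Poly
M k = choose (X +ₚ const (ℕtoℚ k)) k

P : ℕ → Poly
P k = C₂ *ₚ N k *ₚ M k

eval-C₂ : ∀ y → eval C₂ y ≡ (y ℚ.+ ℕtoℚ 2) ℚ.* (y ℚ.+ 1ℚ) ℚ.* invFact 2
eval-C₂ y = trans (eval-choose (X +ₚ const (ℕtoℚ 2)) 2 y) (trans (cong (λ t → invFact 2 ℚ.* falling t 2) (eval-X+const (ℕtoℚ 2) y))
  (solve 1 (λ y → con (invFact 2) :* (con 1ℚ :* (y :+ con (ℕtoℚ 2) :- con (ℕtoℚ 0)) :* (y :+ con (ℕtoℚ 2) :- con (ℕtoℚ 1)))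
                   := (y :+ con (ℕtoℚ 2)) :* (y :+ con 1ℚ) :* con (invFact 2)) refl y))

eval-N : ∀ k y → eval (N k) y ≡ invFact k ℚ.* falling (ℚ.- y ℚ.- ℕtoℚ 3 ℚ.+ ℕtoℚ k) k
eval-N k y = trans (eval-choose _ k y) (cong (λ t → invFact k ℚ.* falling t k) (begin
  eval ((-ₚ X) -ₚ const (ℕtoℚ 3) +ₚ const (ℕtoℚ k)) y        ≡⟨ eval-+ₚ ((-ₚ X) -ₚ const (ℕtoℚ 3)) (const (ℕtoℚ k)) y ⟩
  eval ((-ₚ X) -ₚ const (ℕtoℚ 3)) y ℚ.+ eval (const (ℕtoℚ k)) y
      ≡⟨ cong₂ ℚ._+_ (eval--ₚ (-ₚ X) (const (ℕtoℚ 3)) y) (eval-const (ℕtoℚ k) y) ⟩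
  eval (-ₚ X) y ℚ.- eval (const (ℕtoℚ 3)) y ℚ.+ ℕtoℚ k
      ≡⟨ cong (λ t → eval (-ₚ X) y ℚ.- t ℚ.+ ℕtoℚ k) (eval-const (ℕtoℚ 3) y) ⟩
  eval (-ₚ X) y ℚ.- ℕtoℚ 3 ℚ.+ ℕtoℚ k
      ≡⟨ cong (λ t → t ℚ.- ℕtoℚ 3 ℚ.+ ℕtoℚ k) (solve 1 (λ y → :- con 1ℚ :* con 0ℚ :+ y :* (:- con 1ℚ :* con 1ℚ :+ y :* con 0ℚ) := :- y) refl y) ⟩
  ℚ.- y ℚ.- ℕtoℚ 3 ℚ.+ ℕtoℚ k                                ∎))
  where open ≡-Reasoning

eval-M : ∀ k y → eval (M k) y ≡ invFact k ℚ.* falling (y ℚ.+ ℕtoℚ k) k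
eval-M k y = trans (eval-choose _ k y) (cong (λ t → invFact k ℚ.* falling t k) (eval-X+const (ℕtoℚ k) y))

eval-P : ∀ j x → eval (P j) x ≡ eval C₂ x ℚ.* eval (N j) x ℚ.* eval (M j) x
eval-P j x = trans (eval-*ₚ (C₂ *ₚ N j) (M j) x) (cong (ℚ._* eval (M j) x) (eval-*ₚ C₂ (N j) x))

denominator : ℕ → ℚ
denominator k = ℤtoℚ ((+ (2 ℕ.* k ℕ.+ 3)) ℤ.* (+ (2 ℕ.* k ℕ.+ 1)) ℤ.* ((+ (2 ℕ.* k)) ℤ.- (+ 1)))

denominator-ℚ : ∀ k → denominator k ≡
  (ℕtoℚ 2 ℚ.* ℕtoℚ k ℚ.+ ℕtoℚ 3) ℚ.* (ℕtoℚ 2 ℚ.* ℕtoℚ k ℚ.+ ℕtoℚ 1) ℚ.* (ℕtoℚ 2 ℚ.* ℕtoℚ k ℚ.- ℕtoℚ 1)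
denominator-ℚ k =
  trans (ℤtoℚ-* (+ (2 ℕ.* k ℕ.+ 3) ℤ.* + (2 ℕ.* k ℕ.+ 1)) (+ (2 ℕ.* k) ℤ.- + 1)) (cong₂ ℚ._*_
    (trans (ℤtoℚ-* (+ (2 ℕ.* k ℕ.+ 3)) (+ (2 ℕ.* k ℕ.+ 1))) (cong₂ ℚ._*_
      (trans (ℕtoℚ-+ (2 ℕ.* k) 3) (cong (ℚ._+ ℕtoℚ 3) (ℕtoℚ-* 2 k)))
      (trans (ℕtoℚ-+ (2 ℕ.* k) 1) (cong (ℚ._+ ℕtoℚ 1) (ℕtoℚ-* 2 k)))))
    (trans (ℤtoℚ-+ (+ (2 ℕ.* k)) (ℤ.- + 1)) (cong₂ ℚ._+_ (ℕtoℚ-* 2 k) (ℤtoℚ-neg (+ 1)))))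

ℚ-ring : AlmostCommutativeRing 0ℓ 0ℓ
ℚ-ring = fromCommutativeRing ℚP.+-*-commutativeRing (λ x → dec⇒maybe (0ℚ ℚ.≟ x))

denominator-step-identity : ∀ a a′ μ →
  let κ = 1ℚ ℚ.+ (1ℚ ℚ.+ μ)
      δ = λ t → (ℕtoℚ 2 ℚ.* t ℚ.+ ℕtoℚ 3) ℚ.* (ℕtoℚ 2 ℚ.* t ℚ.+ ℕtoℚ 1) ℚ.* (ℕtoℚ 2 ℚ.* t ℚ.- ℕtoℚ 1)
  in a ℚ.* δ κ ≡ ((ℕtoℚ 2 ℚ.* κ ℚ.+ ℕtoℚ 3) ℚ.* a ℚ.+ (ℕtoℚ 3 ℚ.- ℕtoℚ 2 ℚ.* κ) ℚ.* a′)
                   ℚ.* ((ℕtoℚ 2 ℚ.* κ ℚ.+ ℕtoℚ 1) ℚ.* (ℕtoℚ 2 ℚ.* κ ℚ.- ℕtoℚ 1))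
                 ℚ.+ a′ ℚ.* δ (1ℚ ℚ.+ μ)
denominator-step-identity = solve-∀ ℚ-ring

-- The recurrence identity at x for k = μ + 2, with f = 1/k! and every factor expanded in
-- terms of the falling factorials D and E common to all four products (see Recurrence).
recurrence-identity : ∀ x μ f D E →
  let κ = 1ℚ ℚ.+ (1ℚ ℚ.+ μ)
      g = κ ℚ.* f
      L = λ y → ℚ.- y ℚ.- ℕtoℚ 3 ℚ.+ κ
      C = λ y → (y ℚ.+ ℕtoℚ 2) ℚ.* (y ℚ.+ 1ℚ) ℚ.* invFact 2
      Nx = f ℚ.* (L x ℚ.* ((L x ℚ.- 1ℚ) ℚ.* E))
      N1 = f ℚ.* (L (1ℚ ℚ.+ x) ℚ.* (E ℚ.* (L (1ℚ ℚ.+ x) ℚ.- 1ℚ ℚ.- μ)))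
      Mx = f ℚ.* ((x ℚ.+ κ) ℚ.* (D ℚ.* (x ℚ.+ κ ℚ.- 1ℚ ℚ.- μ)))
      N′ = g ℚ.* ((L x ℚ.- 1ℚ) ℚ.* E)
      M′ = g ℚ.* (D ℚ.* (x ℚ.+ (1ℚ ℚ.+ μ) ℚ.- μ))
      Hx = C x ℚ.* Nx ℚ.* (f ℚ.* (D ℚ.* (x ℚ.+ (1ℚ ℚ.+ μ) ℚ.- μ)))
      H1 = C (1ℚ ℚ.+ x) ℚ.* N1 ℚ.* (f ℚ.* ((1ℚ ℚ.+ x ℚ.+ (1ℚ ℚ.+ μ)) ℚ.* D))
  in (ℕtoℚ 2 ℚ.* κ ℚ.+ ℕtoℚ 3) ℚ.* (C x ℚ.* Nx ℚ.* Mx) ℚ.+ (ℕtoℚ 3 ℚ.- ℕtoℚ 2 ℚ.* κ) ℚ.* (C x ℚ.* N′ ℚ.* M′)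
     ≡ (0ℚ ℚ.+ (1ℚ ℚ.+ x) ℚ.* (0ℚ ℚ.+ (1ℚ ℚ.+ x) ℚ.* H1)) ℚ.- (0ℚ ℚ.+ x ℚ.* (0ℚ ℚ.+ x ℚ.* Hx))
recurrence-identity = solve-∀ ℚ-ring

module Recurrence (B : ℕ → ℚ) (isBernoulli : IsBernoulli B) (m : ℕ) where
  open ≡-Reasoning

  μ κ f g : ℚ
  μ = ℕtoℚ m
  κ = 1ℚ ℚ.+ (1ℚ ℚ.+ μ)
  f = invFact (suc (suc m))
  g = invFact (suc m)

  L D E : ℚ → ℚ
  L y = ℚ.- y ℚ.- ℕtoℚ 3 ℚ.+ κ
  D x = falling (x ℚ.+ (1ℚ ℚ.+ μ)) m
  E x = falling (L x ℚ.- 1ℚ ℚ.- 1ℚ) m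

  ℕtoℚ-1+m : ℕtoℚ (suc m) ≡ 1ℚ ℚ.+ μ
  ℕtoℚ-1+m = ℕtoℚ-suc m

  ℕtoℚ-2+m : ℕtoℚ (suc (suc m)) ≡ κ
  ℕtoℚ-2+m = trans (ℕtoℚ-suc (suc m)) (cong (1ℚ ℚ.+_) ℕtoℚ-1+m)

  g≡κf : g ≡ κ ℚ.* f
  g≡κf = trans (invFact-suc (suc m)) (cong (ℚ._* f) ℕtoℚ-2+m)

  H : Poly
  H = C₂ *ₚ N (suc (suc m)) *ₚ (f ·ₚ fallingProd (X +ₚ const (ℕtoℚ (suc m))) (suc m))

  G : Poly
  G = 0ℚ ∷ 0ℚ ∷ H

  eval-N-2+m : ∀ y → eval (N (suc (suc m))) y ≡ f ℚ.* (L y ℚ.* falling (L y ℚ.- 1ℚ) (suc m))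
  eval-N-2+m y = trans (eval-N (suc (suc m)) y)
    (cong (f ℚ.*_) (trans (cong (λ t → falling (ℚ.- y ℚ.- ℕtoℚ 3 ℚ.+ t) (suc (suc m))) ℕtoℚ-2+m) (falling-suc (L y) (suc m))))

  eval-N-2+m-at-x : ∀ x → eval (N (suc (suc m))) x ≡ f ℚ.* (L x ℚ.* ((L x ℚ.- 1ℚ) ℚ.* E x))
  eval-N-2+m-at-x x = trans (eval-N-2+m x) (cong (λ t → f ℚ.* (L x ℚ.* t)) (falling-suc (L x ℚ.- 1ℚ) m))

  eval-N-2+m-at-1+x : ∀ x → eval (N (suc (suc m))) (1ℚ ℚ.+ x) ≡ f ℚ.* (L (1ℚ ℚ.+ x) ℚ.* (E x ℚ.* (L (1ℚ ℚ.+ x) ℚ.- 1ℚ ℚ.- μ)))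
  eval-N-2+m-at-1+x x = trans (eval-N-2+m (1ℚ ℚ.+ x))
    (cong (λ t → f ℚ.* (L (1ℚ ℚ.+ x) ℚ.* (falling t m ℚ.* (L (1ℚ ℚ.+ x) ℚ.- 1ℚ ℚ.- μ))))
      (solve 2 (λ x κ → :- (con 1ℚ :+ x) :- con (ℕtoℚ 3) :+ κ :- con 1ℚ := :- x :- con (ℕtoℚ 3) :+ κ :- con 1ℚ :- con 1ℚ) refl x κ))

  eval-M-2+m : ∀ x → eval (M (suc (suc m))) x ≡ f ℚ.* ((x ℚ.+ κ) ℚ.* (D x ℚ.* (x ℚ.+ κ ℚ.- 1ℚ ℚ.- μ)))
  eval-M-2+m x = trans (eval-M (suc (suc m)) x) (cong (f ℚ.*_) (begin
    falling (x ℚ.+ ℕtoℚ (suc (suc m))) (suc (suc m))  ≡⟨ cong (λ t → falling (x ℚ.+ t) (suc (suc m))) ℕtoℚ-2+m ⟩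
    falling (x ℚ.+ κ) (suc (suc m))                   ≡⟨ falling-suc (x ℚ.+ κ) (suc m) ⟩
    (x ℚ.+ κ) ℚ.* (falling (x ℚ.+ κ ℚ.- 1ℚ) m ℚ.* (x ℚ.+ κ ℚ.- 1ℚ ℚ.- μ))
        ≡⟨ cong (λ t → (x ℚ.+ κ) ℚ.* (falling t m ℚ.* (x ℚ.+ κ ℚ.- 1ℚ ℚ.- μ)))
             (solve 2 (λ x μ → x :+ (con 1ℚ :+ (con 1ℚ :+ μ)) :- con 1ℚ := x :+ (con 1ℚ :+ μ)) refl x μ) ⟩
    (x ℚ.+ κ) ℚ.* (D x ℚ.* (x ℚ.+ κ ℚ.- 1ℚ ℚ.- μ))   ∎))

  eval-N-1+m : ∀ x → eval (N (suc m)) x ≡ κ ℚ.* f ℚ.* ((L x ℚ.- 1ℚ) ℚ.* E x)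
  eval-N-1+m x = trans (eval-N (suc m) x) (cong₂ ℚ._*_ g≡κf (begin
    falling (ℚ.- x ℚ.- ℕtoℚ 3 ℚ.+ ℕtoℚ (suc m)) (suc m)  ≡⟨ cong (λ t → falling (ℚ.- x ℚ.- ℕtoℚ 3 ℚ.+ t) (suc m)) ℕtoℚ-1+m ⟩
    falling (ℚ.- x ℚ.- ℕtoℚ 3 ℚ.+ (1ℚ ℚ.+ μ)) (suc m)    ≡⟨ cong (λ t → falling t (suc m))
      (solve 2 (λ x μ → :- x :- con (ℕtoℚ 3) :+ (con 1ℚ :+ μ) := :- x :- con (ℕtoℚ 3) :+ (con 1ℚ :+ (con 1ℚ :+ μ)) :- con 1ℚ) refl x μ) ⟩
    falling (L x ℚ.- 1ℚ) (suc m)                        ≡⟨ falling-suc (L x ℚ.- 1ℚ) m ⟩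
    (L x ℚ.- 1ℚ) ℚ.* E x                                ∎))

  eval-M-1+m : ∀ x → eval (M (suc m)) x ≡ κ ℚ.* f ℚ.* (D x ℚ.* (x ℚ.+ (1ℚ ℚ.+ μ) ℚ.- μ))
  eval-M-1+m x = trans (eval-M (suc m) x) (cong₂ ℚ._*_ g≡κf (cong (λ t → falling (x ℚ.+ t) (suc m)) ℕtoℚ-1+m))

  eval-H : ∀ y → eval H y ≡ eval C₂ y ℚ.* eval (N (suc (suc m))) y ℚ.* (f ℚ.* falling (y ℚ.+ (1ℚ ℚ.+ μ)) (suc m))
  eval-H y = trans (eval-*ₚ (C₂ *ₚ N (suc (suc m))) (f ·ₚ fallingProd X+1+m (suc m)) y)
    (cong₂ ℚ._*_ (eval-*ₚ C₂ (N (suc (suc m))) y)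
      (trans (eval-·ₚ f (fallingProd X+1+m (suc m)) y) (cong (f ℚ.*_)
        (trans (eval-fallingProd X+1+m (suc m) y) (cong (λ t → falling t (suc m))
          (trans (eval-X+const (ℕtoℚ (suc m)) y) (cong (y ℚ.+_) ℕtoℚ-1+m)))))))
    where X+1+m = X +ₚ const (ℕtoℚ (suc m))

  eval-H-at-1+x : ∀ x → eval H (1ℚ ℚ.+ x) ≡ eval C₂ (1ℚ ℚ.+ x) ℚ.* eval (N (suc (suc m))) (1ℚ ℚ.+ x) ℚ.* (f ℚ.* ((1ℚ ℚ.+ x ℚ.+ (1ℚ ℚ.+ μ)) ℚ.* D x))
  eval-H-at-1+x x = trans (eval-H (1ℚ ℚ.+ x)) (cong (λ t → eval C₂ (1ℚ ℚ.+ x) ℚ.* eval (N (suc (suc m))) (1ℚ ℚ.+ x) ℚ.* (f ℚ.* t))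
    (trans (falling-suc (1ℚ ℚ.+ x ℚ.+ (1ℚ ℚ.+ μ)) m) (cong (λ t → (1ℚ ℚ.+ x ℚ.+ (1ℚ ℚ.+ μ)) ℚ.* falling t m)
      (solve 2 (λ x μ → con 1ℚ :+ x :+ (con 1ℚ :+ μ) :- con 1ℚ := x :+ (con 1ℚ :+ μ)) refl x μ))))

  c₁ c₂ : ℚ
  c₁ = ℕtoℚ 2 ℚ.* κ ℚ.+ ℕtoℚ 3
  c₂ = ℕtoℚ 3 ℚ.- ℕtoℚ 2 ℚ.* κ

  difference-identity : ∀ x → c₁ ℚ.* eval (P (suc (suc m))) x ℚ.+ c₂ ℚ.* eval (P (suc m)) x ≡ eval G (1ℚ ℚ.+ x) ℚ.- eval G x
  difference-identity x = trans
    (cong₂ (λ s t → c₁ ℚ.* s ℚ.+ c₂ ℚ.* t)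
      (trans (eval-P (suc (suc m)) x) (cong₂ ℚ._*_ (cong₂ ℚ._*_ (eval-C₂ x) (eval-N-2+m-at-x x)) (eval-M-2+m x)))
      (trans (eval-P (suc m) x) (cong₂ ℚ._*_ (cong₂ ℚ._*_ (eval-C₂ x) (eval-N-1+m x)) (eval-M-1+m x))))
    (trans (recurrence-identity x μ f (D x) (E x))
      (sym (cong₂ (λ s t → (0ℚ ℚ.+ (1ℚ ℚ.+ x) ℚ.* (0ℚ ℚ.+ (1ℚ ℚ.+ x) ℚ.* s)) ℚ.- (0ℚ ℚ.+ x ℚ.* (0ℚ ℚ.+ x ℚ.* t)))
        (trans (eval-H-at-1+x x) (cong₂ ℚ._*_ (cong₂ ℚ._*_ (eval-C₂ (1ℚ ℚ.+ x)) (eval-N-2+m-at-1+x x)) refl))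
        (trans (eval-H x) (cong₂ ℚ._*_ (cong₂ ℚ._*_ (eval-C₂ x) (eval-N-2+m-at-x x)) refl)))))

  recurrence : c₁ ℚ.* Ψ B (P (suc (suc m))) ℚ.+ c₂ ℚ.* Ψ B (P (suc m)) ≡ 0ℚ
  recurrence = begin
    c₁ ℚ.* Ψ B (P (suc (suc m))) ℚ.+ c₂ ℚ.* Ψ B (P (suc m))
        ≡⟨ cong₂ ℚ._+_ (Ψ-aux-·ₚ B 0 c₁ (P (suc (suc m)))) (Ψ-aux-·ₚ B 0 c₂ (P (suc m))) ⟨
    Ψ B (c₁ ·ₚ P (suc (suc m))) ℚ.+ Ψ B (c₂ ·ₚ P (suc m))
        ≡⟨ Ψ-aux-+ₚ B 0 (c₁ ·ₚ P (suc (suc m))) (c₂ ·ₚ P (suc m)) ⟨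
    Ψ B (c₁ ·ₚ P (suc (suc m)) +ₚ c₂ ·ₚ P (suc m))
        ≡⟨ Ψ-cong-eval B (c₁ ·ₚ P (suc (suc m)) +ₚ c₂ ·ₚ P (suc m)) (shift G -ₚ G) (λ n → trans lhs-eval (trans (difference-identity (ℕtoℚ n)) (sym rhs-eval))) ⟩
    Ψ B (shift G -ₚ G)          ≡⟨ Ψ--ₚ B (shift G) G ⟩
    Ψ B (shift G) ℚ.- Ψ B G     ≡⟨ cong (ℚ._- Ψ B G) (Ψ-shift B isBernoulli G) ⟩
    Ψ B G ℚ.+ 0ℚ ℚ.- Ψ B G      ≡⟨ solve 1 (λ v → v :+ con 0ℚ :- v := con 0ℚ) refl (Ψ B G) ⟩
    0ℚ                          ∎
    where
    lhs-eval : ∀ {x} → eval (c₁ ·ₚ P (suc (suc m)) +ₚ c₂ ·ₚ P (suc m)) x ≡ c₁ ℚ.* eval (P (suc (suc m))) x ℚ.+ c₂ ℚ.* eval (P (suc m)) x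
    lhs-eval {x} = trans (eval-+ₚ (c₁ ·ₚ P (suc (suc m))) (c₂ ·ₚ P (suc m)) x)
      (cong₂ ℚ._+_ (eval-·ₚ c₁ (P (suc (suc m))) x) (eval-·ₚ c₂ (P (suc m)) x))
    rhs-eval : ∀ {x} → eval (shift G -ₚ G) x ≡ eval G (1ℚ ℚ.+ x) ℚ.- eval G x
    rhs-eval {x} = trans (eval--ₚ (shift G) G x) (cong (ℚ._- eval G x) (eval-shift G x))

  Ψ-P-*-denominator-step : Ψ B (P (suc (suc m))) ℚ.* denominator (suc (suc m)) ≡ Ψ B (P (suc m)) ℚ.* denominator (suc m)
  Ψ-P-*-denominator-step = begin
    a ℚ.* denominator (suc (suc m))
        ≡⟨ cong (a ℚ.*_) (trans (denominator-ℚ (suc (suc m))) (cong δ ℕtoℚ-2+m)) ⟩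
    a ℚ.* δ κ
        ≡⟨ denominator-step-identity a a′ μ ⟩
    (c₁ ℚ.* a ℚ.+ c₂ ℚ.* a′) ℚ.* r ℚ.+ a′ ℚ.* δ (1ℚ ℚ.+ μ)
        ≡⟨ cong (λ t → t ℚ.* r ℚ.+ a′ ℚ.* δ (1ℚ ℚ.+ μ)) recurrence ⟩
    0ℚ ℚ.* r ℚ.+ a′ ℚ.* δ (1ℚ ℚ.+ μ)
        ≡⟨ solve 3 (λ r a′ d → con 0ℚ :* r :+ a′ :* d := a′ :* d) refl r a′ (δ (1ℚ ℚ.+ μ)) ⟩
    a′ ℚ.* δ (1ℚ ℚ.+ μ)
        ≡⟨ cong (a′ ℚ.*_) (trans (denominator-ℚ (suc m)) (cong δ ℕtoℚ-1+m)) ⟨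
    a′ ℚ.* denominator (suc m) ∎
    where
    open ≡-Reasoning
    a = Ψ B (P (suc (suc m)))
    a′ = Ψ B (P (suc m))
    δ : ℚ → ℚ
    δ t = (ℕtoℚ 2 ℚ.* t ℚ.+ ℕtoℚ 3) ℚ.* (ℕtoℚ 2 ℚ.* t ℚ.+ ℕtoℚ 1) ℚ.* (ℕtoℚ 2 ℚ.* t ℚ.- ℕtoℚ 1)
    r = (ℕtoℚ 2 ℚ.* κ ℚ.+ ℕtoℚ 1) ℚ.* (ℕtoℚ 2 ℚ.* κ ℚ.- ℕtoℚ 1)

-- The cases k = 0, 1

-- Only the values below 5 are meaningful.
bernoulli<5 : ℕ → ℚ
bernoulli<5 0 = 1ℚ
bernoulli<5 1 = ℚ.- ((+ 1) / 2)
bernoulli<5 2 = (+ 1) / 6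
bernoulli<5 3 = 0ℚ
bernoulli<5 4 = ℚ.- ((+ 1) / 30)
bernoulli<5 _ = 0ℚ

bernoulli<5-relation : ∀ n → n < 5 → BernoulliRelation bernoulli<5 n
bernoulli<5-relation 0 _ = refl
bernoulli<5-relation 1 _ = refl
bernoulli<5-relation 2 _ = refl
bernoulli<5-relation 3 _ = refl
bernoulli<5-relation 4 _ = refl
bernoulli<5-relation (suc (suc (suc (suc (suc _))))) (s≤s (s≤s (s≤s (s≤s (s≤s ())))))

Ψ-agrees-with-bernoulli<5 : ∀ B → IsBernoulli B → ∀ p → length p ≤ 5 → Ψ B p ≡ Ψ bernoulli<5 p
Ψ-agrees-with-bernoulli<5 B isBernoulli p |p|≤5 = Ψ-aux-cong 0 p (λ j j<|p| →
  bernoulli-unique {B} {bernoulli<5} 5 (λ n _ → isBernoulli n) bernoulli<5-relation j (ℕP.<-≤-trans j<|p| |p|≤5))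

Ψ-bernoulli<5-P₀ : Ψ bernoulli<5 (P 0) ℚ.* denominator 0 ≡ ℚ.- 1ℚ
Ψ-bernoulli<5-P₀ = refl

Ψ-bernoulli<5-P₁ : Ψ bernoulli<5 (P 1) ℚ.* denominator 1 ≡ ℚ.- 1ℚ
Ψ-bernoulli<5-P₁ = refl

lemmaA2 : (B : ℕ → ℚ) → IsBernoulli B → (k : ℕ) →
    Ψ B (choose (X +ₚ const (ℕtoℚ 2)) 2
           *ₚ choose ((-ₚ X) -ₚ const (ℕtoℚ 3) +ₚ const (ℕtoℚ k)) k
           *ₚ choose (X +ₚ const (ℕtoℚ k)) k)
      ℚ.* ℤtoℚ ((+ (2 ℕ.* k ℕ.+ 3)) ℤ.* (+ (2 ℕ.* k ℕ.+ 1)) ℤ.* ((+ (2 ℕ.* k)) ℤ.- (+ 1)))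
    ≡ ℚ.- 1ℚ
lemmaA2 B isBernoulli zero =
  trans (cong (ℚ._* denominator 0) (Ψ-agrees-with-bernoulli<5 B isBernoulli (P 0) (ℕP.m≤m+n 3 2))) Ψ-bernoulli<5-P₀
lemmaA2 B isBernoulli (suc zero) =
  trans (cong (ℚ._* denominator 1) (Ψ-agrees-with-bernoulli<5 B isBernoulli (P 1) ℕP.≤-refl)) Ψ-bernoulli<5-P₁
lemmaA2 B isBernoulli (suc (suc m)) =
  trans (Recurrence.Ψ-P-*-denominator-step B isBernoulli m) (lemmaA2 B isBernoulli (suc m))
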